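{- Let $G$ be a finite undirected graph, $H\in\mathfrak{C}_o$ and $\zeta\in\mathcal{H}_u(G,H)$. Then there is no walk $\mathfrak{c}_0,\dots,\mathfrak{c}_I$ of odd length $I$ in $\mathcal{G}(\zeta)^*$ with $\iota_\zeta(\mathfrak{c}_0)=\iota_\zeta(\mathfrak{c}_I)$. In particular, $\mathcal{G}(\zeta)\in\mathfrak{C}_o$.
   Context: An undirected graph $G$ has a finite non-empty vertex set $V(G)$ and edge set $E(G)$ of one- or two-element subsets of $V(G)$ (one-element edges are loops); $G^*$ is $G$ with loops removed; $\mathfrak{C}_o$ is the class of finite undirected graphs $G$ such that $G^*$ contains no cycle of odd length. A walk of length $I$ is a sequence $v_0,\dots,v_I$ with $\{v_{i-1},v_i\}\in E$ for all $i$. A homomorphism $\zeta:G\to H$ is a map $V(G)\to V(H)$ with $\zeta[e]\in E(H)$ for all $e\in E(G)$; $\mathcal{H}_u(G,H)$ their set. Distinct $v,w$ are adjacent if $\{v,w\}\in E(G)$. For $X\subseteq V(G)$, $v\in X$, $\gamma_X(v)$ = set of $w\in X$ equal to $v$ or joined to $v$ by a sequence in $X$ of consecutively adjacent vertices; $\Gamma_\zeta(v)=\gamma_{\zeta^{ -1}(\zeta(v))}(v)$. $\mathcal{G}(\zeta)$ is the undirected graph with vertex set $\{\Gamma_\zeta(v): v\in V(G)\}$ and edges $\{\mathfrak{a},\mathfrak{b}\}$ whenever there are $a\in\mathfrak{a}$, $b\in\mathfrak{b}$ with $\{a,b\}\in E(G)$; $\iota_\zeta:V(\mathcal{G}(\zeta))\to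 V(H)$, $\Gamma_\zeta(v)\mapsto\zeta(v)$. -}

module Defs where

open import Data.Nat using (ℕ; zero; suc; _+_; _*_; _<_; _≤_)
open import Data.Fin using (Fin)
open import Data.Bool using (Bool; true)
open import Data.Product using (Σ; ∃; _×_; _,_)
open import Relation.Binary.PropositionalEquality using (_≡_; _≢_)
open import Relation.Nullary using (¬_)

-- The edge set (one- or two-element subsets) is encoded by a symmetric
-- Boolean adjacency: adj v v ≡ true means the loop {v} is an edge,
-- adj v w ≡ true (v ≠ w) means {v,w} is an edge.
record Graph : Set where
  field
    n   : ℕ
    adj : Fin (suc n) → Fin (suc n) → Bool
    sym : ∀ v w → adj v w ≡ adj w v

open Graph public

V : Graph → Set
V G = Fin (suc (n G))

Edge : (G : Graph) → V G → V G → Set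
Edge G v w = adj G v w ≡ true

-- adjacency of distinct vertices (= edge relation of G*)
Adjacent : (G : Graph) → V G → V G → Set
Adjacent G v w = v ≢ w × Edge G v w

IsOdd : ℕ → Set
IsOdd I = Σ ℕ λ k → I ≡ suc (2 * k)

IsWalk : {A : Set} → (A → A → Set) → (ℕ → A) → ℕ → Set
IsWalk R c I = ∀ i → i < I → R (c i) (c (suc i))

IsCycle : {A : Set} → (A → A → Set) → (A → A → Set) → (ℕ → A) → ℕ → Set
IsCycle _≈_ R c I =
  3 ≤ I × IsWalk R c I × (c 0 ≈ c I) ×
  (∀ i j → i < I → j < I → c i ≈ c j → i ≡ j)

NoOddCycle : {A : Set} → (A → A → Set) → (A → A → Set) → Set
NoOddCycle _≈_ R = ∀ c I → IsOdd I → ¬ IsCycle _≈_ R c I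

InCo : Graph → Set
InCo G = NoOddCycle _≡_ (Adjacent G)

IsHom : (G H : Graph) → (V G → V H) → Set
IsHom G H ζ = ∀ v w → Edge G v w → Edge H (ζ v) (ζ w)

data InΓ (G H : Graph) (ζ : V G → V H) (v : V G) : V G → Set where
  here : InΓ G H ζ v v
  step : ∀ {u w} → InΓ G H ζ v u → Adjacent G u w → ζ w ≡ ζ v → InΓ G H ζ v w

-- The graph 𝒢(ζ): its vertices Γ_ζ(u) are represented by representatives
-- u ∈ V(G); two representatives denote the same vertex iff the sets agree.
SameΓ : (G H : Graph) (ζ : V G → V H) → V G → V G → Set
SameΓ G H ζ u w = ∀ x → (InΓ G H ζ u x → InΓ G H ζ w x) × (InΓ G H ζ w x → InΓ G H ζ u x)

𝒢Edge : (G H : Graph) (ζ : V G → V H) → V G → V G → Set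
𝒢Edge G H ζ u w = ∃ λ a → ∃ λ b → InΓ G H ζ u a × InΓ G H ζ w b × Edge G a b

𝒢Adj* : (G H : Graph) (ζ : V G → V H) → V G → V G → Set
𝒢Adj* G H ζ u w = ¬ SameΓ G H ζ u w × 𝒢Edge G H ζ u w

ι : (G H : Graph) (ζ : V G → V H) → V G → V H
ι G H ζ u = ζ u

{-# OPTIONS --safe #-}
-- ζ is constant on each class Γ_ζ(v), and an edge of 𝒢(ζ)* joins two classes
-- with different images: an edge of G inside one fibre of ζ would merge the
-- two classes into one. Hence ι_ζ maps walks of 𝒢(ζ)* to walks of H*, and an
-- odd walk with ι_ζ(𝔠₀) = ι_ζ(𝔠_I) becomes an odd closed walk of H*. But in a
-- loopless graph a shortest odd closed walk is an odd cycle: at a repeated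
-- vertex it splits into two shorter closed walks, one of which is odd.
module Submission where

open import Defs hiding (sym)
open import Data.Nat
  using (ℕ; suc; _+_; _*_; _∸_; _<_; _≤_; z≤n; s≤s; z<s; _≤?_; parity)
open import Data.Nat.Properties
  using (+-suc; +-comm; ≤-refl; ≤-trans; <⇒≱; <⇒≤; <-trans; ≤-<-trans; <-cmp; n<1+n;
         m≤m+n; m≤n+m; +-monoˡ-<; m∸n+n≡m; m+n≤o⇒m≤o∸n; ∸-monoʳ-<; m≤n⇒∃[o]m+o≡n; anyUpTo?)
open import Data.Nat.Induction using (<-rec)
open import Data.Parity.Base as ℙ using (0ℙ; 1ℙ)
open import Data.Parity.Properties using (+-homo-+; *-homo-*)
open import Data.Fin using () renaming (_≟_ to _≟ᶠ_)
open import Data.Product using (Σ; ∃₂; _×_; _,_; proj₁)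
open import Data.Sum using (_⊎_; inj₁; inj₂; [_,_]′)
open import Data.Empty using (⊥; ⊥-elim)
open import Function using (_∘_)
open import Relation.Nullary using (¬_; yes; no)
open import Relation.Binary.Definitions
  using (DecidableEquality; Irreflexive; tri<; tri≈; tri>)
open import Relation.Binary.PropositionalEquality
  using (_≡_; _≢_; refl; sym; trans; cong; subst; subst₂; module ≡-Reasoning)

IsOdd⇒parity≡1ℙ : ∀ {n} → IsOdd n → parity n ≡ 1ℙ
IsOdd⇒parity≡1ℙ (k , refl) = trans (+-homo-+ 1 (2 * k)) (cong (1ℙ ℙ.+_) (*-homo-* 2 k))

parity≡1ℙ⇒IsOdd : ∀ n → parity n ≡ 1ℙ → IsOdd n
parity≡1ℙ⇒IsOdd 1 _ = 0 , refl
parity≡1ℙ⇒IsOdd (suc (suc n)) odd with parity≡1ℙ⇒IsOdd n odd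
... | k , refl = suc k , cong (suc ∘ suc) (sym (+-suc k (k + 0)))

parity-odd-summand : ∀ m n → parity (m + n) ≡ 1ℙ → parity m ≡ 1ℙ ⊎ parity n ≡ 1ℙ
parity-odd-summand m n odd = odd-summand (parity m) (parity n) (trans (sym (+-homo-+ m n)) odd)
  where
  odd-summand : ∀ p q → p ℙ.+ q ≡ 1ℙ → p ≡ 1ℙ ⊎ q ≡ 1ℙ
  odd-summand 1ℙ q _ = inj₁ refl
  odd-summand 0ℙ q q≡1ℙ = inj₂ q≡1ℙ

module _ {A : Set} where

  DistinctBelow : (ℕ → A) → ℕ → Set
  DistinctBelow c I = ∀ i j → i < I → j < I → c i ≡ c j → i ≡ j

  Repetition : (ℕ → A) → ℕ → Set
  Repetition c I = ∃₂ λ i D → 0 < D × i + D < I × c i ≡ c (i + D)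

  repetition-or-distinct : DecidableEquality A → ∀ c I → Repetition c I ⊎ DistinctBelow c I
  repetition-or-distinct _≟_ c I
    with anyUpTo? (λ j → anyUpTo? (λ i → c i ≟ c j) j) I
  ... | yes (j , j<I , i , i<j , ci≡cj) with m≤n⇒∃[o]m+o≡n i<j
  ...   | D , refl = inj₁ (i , suc D , z<s , subst (_< I) (sym (+-suc i D)) j<I ,
                           trans ci≡cj (cong c (sym (+-suc i D))))
  repetition-or-distinct _≟_ c I | no no-repetition = inj₂ distinct
    where
    distinct : DistinctBelow c I
    distinct i j i<I j<I ci≡cj with <-cmp i j
    ... | tri< i<j _ _ = ⊥-elim (no-repetition (j , j<I , i , i<j , ci≡cj))
    ... | tri≈ _ i≡j _ = i≡j
    ... | tri> _ _ j<i = ⊥-elim (no-repetition (i , i<I , j , j<i , sym ci≡cj))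

  -- c 0, …, c i, c (i + D + 1), …, c I: the segment between the two visits
  -- of c i ≡ c (i + D) is cut out.
  shortcut : (ℕ → A) → ℕ → ℕ → ℕ → A
  shortcut c i D k with k ≤? i
  ... | yes _ = c k
  ... | no _ = c (k + D)

  shortcut-≤ : ∀ c i D {k} → k ≤ i → shortcut c i D k ≡ c k
  shortcut-≤ c i D {k} k≤i with k ≤? i
  ... | yes _ = refl
  ... | no k≰i = ⊥-elim (k≰i k≤i)

  shortcut-> : ∀ c i D {k} → i < k → shortcut c i D k ≡ c (k + D)
  shortcut-> c i D {k} i<k with k ≤? i
  ... | yes k≤i = ⊥-elim (<⇒≱ i<k k≤i)
  ... | no _ = refl

IsClosedWalk : {A : Set} → (A → A → Set) → (ℕ → A) → ℕ → Set
IsClosedWalk R c I = IsWalk R c I × c 0 ≡ c I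

module _ {A : Set} (R : A → A → Set) where

  loop-closedWalk : ∀ {c I i D} → IsWalk R c I → i + D ≤ I → c i ≡ c (i + D) →
                    IsClosedWalk R (λ k → c (k + i)) D
  loop-closedWalk {c} {I} {i} {D} walk i+D≤I ci≡ci+D =
    (λ k k<D → walk (k + i) (≤-trans (+-monoˡ-< i k<D) D+i≤I)) ,
    trans ci≡ci+D (cong c (+-comm i D))
    where
    D+i≤I : D + i ≤ I
    D+i≤I = subst (_≤ I) (+-comm i D) i+D≤I

  shortcut-closedWalk : ∀ {c I i D} → IsClosedWalk R c I → i + D < I → c i ≡ c (i + D) →
                        IsClosedWalk R (shortcut c i D) (I ∸ D)
  shortcut-closedWalk {c} {I} {i} {D} (walk , c0≡cI) i+D<I ci≡ci+D = shortcut-walk , closed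
    where
    I∸D+D≡I : I ∸ D + D ≡ I
    I∸D+D≡I = m∸n+n≡m (≤-trans (m≤n+m D i) (<⇒≤ i+D<I))

    i<I : i < I
    i<I = ≤-<-trans (m≤m+n i D) i+D<I

    shortcut-walk : IsWalk R (shortcut c i D) (I ∸ D)
    shortcut-walk k k<I∸D with <-cmp k i
    ... | tri< k<i _ _ =
      subst₂ R (sym (shortcut-≤ c i D (<⇒≤ k<i))) (sym (shortcut-≤ c i D k<i))
        (walk k (<-trans k<i i<I))
    ... | tri≈ _ refl _ =
      subst₂ R (trans (sym ci≡ci+D) (sym (shortcut-≤ c i D ≤-refl)))
        (sym (shortcut-> c i D ≤-refl)) (walk (k + D) i+D<I)
    ... | tri> _ _ i<k =
      subst₂ R (sym (shortcut-> c i D i<k)) (sym (shortcut-> c i D (<-trans i<k (n<1+n k))))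
        (walk (k + D) (subst (k + D <_) I∸D+D≡I (+-monoˡ-< D k<I∸D)))

    closed : shortcut c i D 0 ≡ shortcut c i D (I ∸ D)
    closed = begin
      shortcut c i D 0        ≡⟨ shortcut-≤ c i D z≤n ⟩
      c 0                     ≡⟨ c0≡cI ⟩
      c I                     ≡⟨ cong c I∸D+D≡I ⟨
      c (I ∸ D + D)           ≡⟨ shortcut-> c i D (m+n≤o⇒m≤o∸n (suc i) i+D<I) ⟨
      shortcut c i D (I ∸ D)  ∎
      where open ≡-Reasoning

  ShorterOddClosedWalk : ℕ → Set
  ShorterOddClosedWalk I = ∃₂ λ J c′ → J < I × parity J ≡ 1ℙ × IsClosedWalk R c′ J

  repetition-shortens-oddClosedWalk :
    ∀ {c I} → parity I ≡ 1ℙ → IsClosedWalk R c I → Repetition c I → ShorterOddClosedWalk I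
  repetition-shortens-oddClosedWalk {c} {I} odd closed (i , D , 0<D , i+D<I , ci≡ci+D) =
    [ via-shortcut , via-loop ]′
      (parity-odd-summand (I ∸ D) D (subst (λ n → parity n ≡ 1ℙ) (sym (m∸n+n≡m D≤I)) odd))
    where
    D≤I : D ≤ I
    D≤I = ≤-trans (m≤n+m D i) (<⇒≤ i+D<I)

    via-shortcut : parity (I ∸ D) ≡ 1ℙ → ShorterOddClosedWalk I
    via-shortcut shortcut-odd =
      I ∸ D , shortcut c i D , ∸-monoʳ-< 0<D D≤I , shortcut-odd ,
      shortcut-closedWalk closed i+D<I ci≡ci+D

    via-loop : parity D ≡ 1ℙ → ShorterOddClosedWalk I
    via-loop loop-odd =
      D , (λ k → c (k + i)) , ≤-<-trans (m≤n+m D i) i+D<I , loop-odd ,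
      loop-closedWalk (proj₁ closed) (<⇒≤ i+D<I) ci≡ci+D

  module _ (_≟_ : DecidableEquality A) (R-irrefl : Irreflexive _≡_ R)
           (no-odd-cycle : NoOddCycle _≡_ R) where

    distinct-oddClosedWalk⇒⊥ : ∀ {c} I → parity I ≡ 1ℙ → IsClosedWalk R c I →
                               DistinctBelow c I → ⊥
    distinct-oddClosedWalk⇒⊥ 1 _ (walk , c0≡c1) _ = R-irrefl c0≡c1 (walk 0 z<s)
    distinct-oddClosedWalk⇒⊥ {c} I@(suc (suc (suc _))) odd (walk , c0≡cI) distinct =
      no-odd-cycle c I (parity≡1ℙ⇒IsOdd I odd) (s≤s (s≤s (s≤s z≤n)) , walk , c0≡cI , distinct)

    oddClosedWalk⇒⊥ : ∀ I {c} → parity I ≡ 1ℙ → ¬ IsClosedWalk R c I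
    oddClosedWalk⇒⊥ = <-rec (λ I → ∀ {c} → parity I ≡ 1ℙ → ¬ IsClosedWalk R c I) induction-step
      where
      induction-step : ∀ I → (∀ {J} → J < I → ∀ {c} → parity J ≡ 1ℙ → ¬ IsClosedWalk R c J) →
                       ∀ {c} → parity I ≡ 1ℙ → ¬ IsClosedWalk R c I
      induction-step I shorter {c} odd closed with repetition-or-distinct _≟_ c I
      ... | inj₂ distinct = distinct-oddClosedWalk⇒⊥ I odd closed distinct
      ... | inj₁ repetition with repetition-shortens-oddClosedWalk odd closed repetition
      ...   | J , c′ , J<I , J-odd , closed′ = shorter J<I J-odd closed′

Adjacent-irrefl : ∀ G → Irreflexive _≡_ (Adjacent G)
Adjacent-irrefl G refl (u≢u , _) = u≢u refl

Adjacent-sym : ∀ G {u w} → Adjacent G u w → Adjacent G w u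
Adjacent-sym G {u} {w} (u≢w , uw) = u≢w ∘ sym , trans (Graph.sym G w u) uw

module _ {G H : Graph} {ζ : V G → V H} where

  InΓ⇒ζ≡ : ∀ {v x} → InΓ G H ζ v x → ζ x ≡ ζ v
  InΓ⇒ζ≡ here = refl
  InΓ⇒ζ≡ (step _ _ ζw≡ζv) = ζw≡ζv

  InΓ-trans : ∀ {v u w} → InΓ G H ζ v u → InΓ G H ζ u w → InΓ G H ζ v w
  InΓ-trans vu here = vu
  InΓ-trans vu (step ux xw ζw≡ζu) = step (InΓ-trans vu ux) xw (trans ζw≡ζu (InΓ⇒ζ≡ vu))

  InΓ-sym : ∀ {v w} → InΓ G H ζ v w → InΓ G H ζ w v
  InΓ-sym here = here
  InΓ-sym (step vu uw ζw≡ζv) =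
    InΓ-trans (step here (Adjacent-sym G uw) (trans (InΓ⇒ζ≡ vu) (sym ζw≡ζv))) (InΓ-sym vu)

  InΓ-common⇒SameΓ : ∀ {u w x} → InΓ G H ζ u x → InΓ G H ζ w x → SameΓ G H ζ u w
  InΓ-common⇒SameΓ ux wx _ =
    InΓ-trans (InΓ-trans wx (InΓ-sym ux)) , InΓ-trans (InΓ-trans ux (InΓ-sym wx))

  𝒢Adj*⇒Adjacent : IsHom G H ζ → ∀ {u w} → 𝒢Adj* G H ζ u w → Adjacent H (ζ u) (ζ w)
  𝒢Adj*⇒Adjacent hom {u} {w} (¬same , a , b , ua , wb , ab) =
    ζu≢ζw , subst₂ (Edge H) (InΓ⇒ζ≡ ua) (InΓ⇒ζ≡ wb) (hom a b ab)
    where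
    ζu≢ζw : ζ u ≢ ζ w
    ζu≢ζw ζu≡ζw with a ≟ᶠ b
    ... | yes refl = ¬same (InΓ-common⇒SameΓ ua wb)
    ... | no a≢b = ¬same (InΓ-common⇒SameΓ ub wb)
      where
      ub : InΓ G H ζ u b
      ub = step ua (a≢b , ab) (trans (InΓ⇒ζ≡ wb) (sym ζu≡ζw))

lemma9 : (G H : Graph) → InCo H → (ζ : V G → V H) → IsHom G H ζ →
    (¬ (Σ (ℕ → V G) λ c → Σ ℕ λ I →
          IsOdd I × IsWalk (𝒢Adj* G H ζ) c I × (ι G H ζ (c 0) ≡ ι G H ζ (c I))))
    × NoOddCycle (SameΓ G H ζ) (𝒢Adj* G H ζ)
lemma9 G H H-odd-cycle-free ζ hom = no-odd-walk , no-odd-cycle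
  where
  no-odd-walk : ¬ (Σ (ℕ → V G) λ c → Σ ℕ λ I →
                     IsOdd I × IsWalk (𝒢Adj* G H ζ) c I × (ι G H ζ (c 0) ≡ ι G H ζ (c I)))
  no-odd-walk (c , I , odd , walk , ιc0≡ιcI) =
    oddClosedWalk⇒⊥ (Adjacent H) _≟ᶠ_ (Adjacent-irrefl H) H-odd-cycle-free
      I (IsOdd⇒parity≡1ℙ odd)
      ((λ k k<I → 𝒢Adj*⇒Adjacent hom (walk k k<I)) , ιc0≡ιcI)

  no-odd-cycle : NoOddCycle (SameΓ G H ζ) (𝒢Adj* G H ζ)
  no-odd-cycle c I odd (_ , walk , c0≈cI , _) =
    no-odd-walk (c , I , odd , walk , InΓ⇒ζ≡ (proj₁ (c0≈cI (c 0)) here))
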